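{- For every nonempty $A\subseteq\{0,1\}^m$, ${\rm ETD}(A)\le \ln|A|\cdot{\rm DEN}(A)+1$.
   Context: For $h\in\{0,1\}^m$, a set $S\subseteq[m]$ is a specifying set for $h$ with respect to $A$ if at most one $a\in A$ satisfies $a_i=h_i$ for all $i\in S$; ${\rm ETD}(A,h)$ is the minimum size of such a set and ${\rm ETD}(A)=\max_{h\in\{0,1\}^m}{\rm ETD}(A,h)$. For $B\subseteq\{0,1\}^m$, $j\in[m]$, $\xi\in\{0,1\}$ let $B_{j,\xi}=\{b\in B\mid b_j=\xi\}$ and ${\rm MAMI}(B)=\max_{j\in[m]}\min(|B_{j,0}|,|B_{j,1}|)$. The density is ${\rm DEN}(A)=\max_{B\subseteq A}\frac{|B|-1}{{\rm MAMI}(B)}$ (subsets $B$ with $|B|\le 1$, for which ${\rm MAMI}(B)=0$, are understood to contribute $0$). -}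

module Defs where

open import Data.Bool using (Bool; true; false; if_then_else_; _∧_)
open import Data.Bool.Properties using () renaming (_≟_ to _≟B_)
open import Data.Nat using (ℕ; zero; suc; _+_; _*_; _∸_; _⊔_; _⊓_; _≤?_) renaming (_≤_ to _≤ℕ_)
open import Data.Fin using (Fin)
open import Data.Fin.Subset using (Subset; ∣_∣)
open import Data.Vec using (Vec; []; _∷_; lookup)
open import Data.List using (List; []; _∷_; map; filter; length; foldr; _++_; allFin)
open import Data.Integer using (+_)
import Data.Integer as ℤ
open import Data.Rational using (ℚ; 0ℚ; 1ℚ; _/_; ↥_; ↧ₙ_; _≤_) renaming (_⊔_ to _⊔ℚ_; _+_ to _+ℚ_; _*_ to _*ℚ_)
open import Data.Nat using (_!)
open import Data.Nat.Properties using (_!≢0)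
open import Relation.Nullary.Decidable using (⌊_⌋)

Cube : ℕ → Set
Cube m = Vec Bool m

-- all vectors of length m (enumeration of {0,1}^m, also of subsets of [m])
allVecs : (m : ℕ) → List (Vec Bool m)
allVecs zero    = [] ∷ []
allVecs (suc m) = map (false ∷_) (allVecs m) ++ map (true ∷_) (allVecs m)

sublists : {X : Set} → List X → List (List X)
sublists []       = [] ∷ []
sublists (x ∷ xs) = sublists xs ++ map (x ∷_) (sublists xs)

agreesOn : {m : ℕ} → Subset m → Cube m → Cube m → Bool
agreesOn {m} S h a =
  foldr _∧_ true
    (map (λ i → if lookup S i then ⌊ lookup a i ≟B lookup h i ⌋ else true) (allFin m))

matchCount : {m : ℕ} → List (Cube m) → Cube m → Subset m → ℕ
matchCount A h S = length (filter (λ a → agreesOn S h a ≟B true) A)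

IsSpecifying : {m : ℕ} → List (Cube m) → Cube m → Subset m → Set
IsSpecifying A h S = matchCount A h S ≤ℕ 1

-- ETD(A,h): minimum size of a specifying set (minimum over all S ⊆ [m];
-- the default m is attained by S = [m] whenever A has no repeated elements)
ETDh : {m : ℕ} → List (Cube m) → Cube m → ℕ
ETDh {m} A h =
  foldr (λ S acc → if ⌊ matchCount A h S ≤? 1 ⌋ then ∣ S ∣ ⊓ acc else acc) m (allVecs m)

ETD : {m : ℕ} → List (Cube m) → ℕ
ETD {m} A = foldr (λ h acc → ETDh A h ⊔ acc) 0 (allVecs m)

countAt : {m : ℕ} → List (Cube m) → Fin m → Bool → ℕ
countAt B j ξ = length (filter (λ b → lookup b j ≟B ξ) B)

MAMI : {m : ℕ} → List (Cube m) → ℕ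
MAMI {m} B = foldr (λ j acc → (countAt B j false ⊓ countAt B j true) ⊔ acc) 0 (allFin m)

-- p / q as a rational, with the convention p / 0 = 0
frac : ℕ → ℕ → ℚ
frac p zero    = 0ℚ
frac p (suc q) = (+ p) / suc q

-- DEN(A) = max over B ⊆ A of (|B|-1)/MAMI(B); subsets with |B| ≤ 1 contribute 0
DEN : {m : ℕ} → List (Cube m) → ℚ
DEN A = foldr (λ B acc → frac (length B ∸ 1) (MAMI B) ⊔ℚ acc) 0ℚ (sublists A)

_^ℚ_ : ℚ → ℕ → ℚ
q ^ℚ zero  = 1ℚ
q ^ℚ suc n = q *ℚ (q ^ℚ n)

-- eApprox n = Σ_{j<n} 1/j!  (partial sums of e; they increase strictly to e)
eApprox : ℕ → ℚ
eApprox zero    = 0ℚ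
eApprox (suc n) = eApprox n +ℚ ((+ 1) / (n !)) {{n !≢0}}

fromℕℚ : ℕ → ℚ
fromℕℚ n = (+ n) / 1

-- LeLnTimes k N D  encodes the real inequality  k ≤ ln N · D
-- for k, N ∈ ℕ and a rational D ≥ 0 written D = p/q in lowest terms:
--   k ≤ ln N · p/q  ⇔  e^(k q) ≤ N^p  ⇔  ∀ n, (Σ_{j<n} 1/j!)^(k q) ≤ N^p.
LeLnTimes : ℕ → ℕ → ℚ → Set
LeLnTimes k N D = ∀ (n : ℕ) → eApprox n ^ℚ (k * ↧ₙ D) ≤ fromℕℚ N ^ℚ ℤ.∣ ↥ D ∣

{-# OPTIONS --safe #-}
module Submission where

-- Fix h and write DEN(A) = p/q. Grow S greedily from ∅, each time adding a coordinate j at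
-- which the set B of vectors of A agreeing with h on S attains MAMI(B). Density gives
-- MAMI(B) ≥ q(|B| − 1)/p, so c = |B| shrinks as c′ − 1 ≤ (c − 1)(1 − q/p). If ETD(A,h) = k + 1
-- the greedy run is still unfinished after k steps, whence (p/(p − q))^k ≤ |A| − 1 and
-- e^(kq) ≤ (p/(p − q))^(kp) ≤ |A|^p, i.e. k ≤ ln|A| · p/q. The inequality e^q ≤ (p/(p − q))^p
-- telescopes from e ≤ (1 + 1/r)^(r+1) for p − q ≤ r < p; and e ≤ (1 + 1/L)^(L+1) holds because,
-- termwise, (L+1)^i / i! ≤ C(L+i, i), the coefficients of (1 − 1/(L+1))^(−(L+1)).

open import Defs
open import Data.Nat using (ℕ; _∸_)
open import Data.Bool using (Bool)
open import Data.Vec using (Vec)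
open import Data.List using (List; []; length)
open import Data.List.Relation.Unary.Unique.Propositional using (Unique)
open import Relation.Binary.PropositionalEquality using (_≢_)

module EulerBound where

  open import Data.Nat
  open import Data.Nat.Properties
  open import Data.Nat.Tactic.RingSolver using (solve-∀)
  open import Algebra.Properties.CommutativeSemigroup *-commutativeSemigroup
    using (xy∙z≈y∙xz; x∙yz≈y∙xz; xy∙z≈xz∙y)
  open import Relation.Binary.PropositionalEquality
  open import Relation.Nullary using (contradiction)
  open ≤-Reasoning

  -- multichoose k j = C(k + j − 1, j); the last clause is Pascal's rule.
  multichoose : ℕ → ℕ → ℕ
  multichoose k       zero    = 1
  multichoose zero    (suc j) = 0
  multichoose (suc k) (suc j) = multichoose (suc k) j + multichoose k (suc j)

  suc-^-≤ : ∀ k j → suc k ^ suc j ≤ k ^ suc j + suc j * suc k ^ j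
  suc-^-≤ k zero    = ≤-reflexive (base k)
    where
    base : ∀ k → suc k * 1 ≡ k * 1 + 1 * 1
    base = solve-∀
  suc-^-≤ k (suc j) = begin
    suc k * suc k ^ suc j                        ≤⟨ *-monoʳ-≤ (suc k) (suc-^-≤ k j) ⟩
    suc k * (k ^ suc j + suc j * suc k ^ j)      ≡⟨ expand k (k ^ suc j) j (suc k ^ j) ⟩
    k ^ suc (suc j) + (k ^ suc j + suc j * suc k ^ suc j)
      ≤⟨ +-monoʳ-≤ (k ^ suc (suc j)) (+-monoˡ-≤ _ (^-monoˡ-≤ (suc j) (n≤1+n k))) ⟩
    k ^ suc (suc j) + suc (suc j) * suc k ^ suc j ∎
    where
    expand : ∀ k a j c → suc k * (a + suc j * c) ≡ k * a + (a + suc j * (suc k * c))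
    expand = solve-∀

  ^≤multichoose*! : ∀ k j → k ^ j ≤ multichoose k j * j !
  ^≤multichoose*! k       zero    = ≤-refl
  ^≤multichoose*! zero    (suc j) = z≤n
  ^≤multichoose*! (suc k) (suc j) = begin
    suc k ^ suc j                                                   ≤⟨ suc-^-≤ k j ⟩
    k ^ suc j + suc j * suc k ^ j
      ≤⟨ +-mono-≤ (^≤multichoose*! k (suc j)) (*-monoʳ-≤ (suc j) (^≤multichoose*! (suc k) j)) ⟩
    multichoose k (suc j) * suc j ! + suc j * (multichoose (suc k) j * j !)
      ≡⟨ collect (multichoose k (suc j)) (multichoose (suc k) j) j (j !) ⟩
    multichoose (suc k) (suc j) * suc j ! ∎
    where
    collect : ∀ a b j f → a * (suc j * f) + suc j * (b * f) ≡ (b + a) * (suc j * f)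
    collect = solve-∀

  module _ (M : ℕ) where

    -- negBinom m n = Σ_{i ≤ n} M^(n − i) · C(m + i − 1, i): M^n times a partial sum of (1 − 1/M)^(−m).
    negBinom : ℕ → ℕ → ℕ
    negBinom m zero    = 1
    negBinom m (suc n) = M * negBinom m n + multichoose m (suc n)

    negBinom-pascal : ∀ m n → M * negBinom (suc m) n + multichoose (suc m) n ≡ negBinom (suc m) n + M * negBinom m n
    negBinom-pascal m zero    = +-comm (M * 1) 1
    negBinom-pascal m (suc n) = begin-equality
      M * (M * x + (a + b)) + (a + b)  ≡⟨ regroup M x a b ⟩
      M * (M * x + a) + (M * b + (a + b))  ≡⟨ cong (λ w → M * w + (M * b + (a + b))) (negBinom-pascal m n) ⟩
      M * (x + M * y) + (M * b + (a + b))  ≡⟨ regroup′ M x y b (a + b) ⟩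
      (M * x + (a + b)) + M * (M * y + b) ∎
      where
      x = negBinom (suc m) n
      y = negBinom m n
      a = multichoose (suc m) n
      b = multichoose m (suc n)
      regroup : ∀ M x a b → M * (M * x + (a + b)) + (a + b) ≡ M * (M * x + a) + (M * b + (a + b))
      regroup = solve-∀
      regroup′ : ∀ M x y b c → M * (x + M * y) + (M * b + c) ≡ (M * x + c) + M * (M * y + b)
      regroup′ = solve-∀

    negBinom-zero : ∀ n → negBinom 0 n ≡ M ^ n
    negBinom-zero zero    = refl
    negBinom-zero (suc n) = trans (+-identityʳ (M * negBinom 0 n)) (cong (M *_) (negBinom-zero n))

  negBinom-step : ∀ L m n → L * negBinom (suc L) (suc m) n ≤ suc L * negBinom (suc L) m n
  negBinom-step L m n = begin
    L * x      ≤⟨ m≤m+n (L * x) a ⟩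
    L * x + a  ≡⟨ +-cancelˡ-≡ x _ _ (trans (sym (+-assoc x (L * x) a)) (negBinom-pascal (suc L) m n)) ⟩
    suc L * negBinom (suc L) m n ∎
    where
    x = negBinom (suc L) (suc m) n
    a = multichoose (suc m) n

  negBinom-bound : ∀ L m n → L ^ m * negBinom (suc L) m n ≤ suc L ^ (m + n)
  negBinom-bound L zero    n = ≤-reflexive (trans (*-identityˡ _) (negBinom-zero (suc L) n))
  negBinom-bound L (suc m) n = begin
    L * L ^ m * negBinom (suc L) (suc m) n    ≡⟨ xy∙z≈y∙xz L (L ^ m) _ ⟩
    L ^ m * (L * negBinom (suc L) (suc m) n)  ≤⟨ *-monoʳ-≤ (L ^ m) (negBinom-step L m n) ⟩
    L ^ m * (suc L * negBinom (suc L) m n)    ≡⟨ x∙yz≈y∙xz (L ^ m) (suc L) _ ⟩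
    suc L * (L ^ m * negBinom (suc L) m n)    ≤⟨ *-monoʳ-≤ (suc L) (negBinom-bound L m n) ⟩
    suc L * suc L ^ (m + n)                   ∎

  -- eApprox n = eNum n / eDen n, with the unreduced denominator eDen n = ∏_{j<n} j! that
  -- adding up the fractions 1/j! produces.
  eNum eDen : ℕ → ℕ
  eNum zero    = 0
  eNum (suc n) = eNum n * n ! + eDen n
  eDen zero    = 1
  eDen (suc n) = eDen n * n !

  eDen≢0 : ∀ n → NonZero (eDen n)
  eDen≢0 zero    = _
  eDen≢0 (suc n) = m*n≢0 (eDen n) (n !) {{eDen≢0 n}} {{n !≢0}}

  eNum≤negBinom : ∀ M n → eNum (suc n) * M ^ n ≤ negBinom M M n * eDen (suc n)
  eNum≤negBinom M zero    = ≤-refl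
  eNum≤negBinom M (suc n) = begin
    (x * f + y) * (M * M ^ n)           ≡⟨ spread x f y M (M ^ n) ⟩
    f * M * (x * M ^ n) + y * (M * M ^ n)
      ≤⟨ +-mono-≤ (*-monoʳ-≤ (f * M) (eNum≤negBinom M n)) (*-monoʳ-≤ y (^≤multichoose*! M (suc n))) ⟩
    f * M * (h * y) + y * (c * f)       ≡⟨ collect f M h y c ⟩
    (M * h + c) * (y * f)               ∎
    where
    x = eNum (suc n)
    y = eDen (suc n)
    f = suc n !
    h = negBinom M M n
    c = multichoose M (suc n)
    spread : ∀ x f y m p → (x * f + y) * (m * p) ≡ f * m * (x * p) + y * (m * p)
    spread = solve-∀
    collect : ∀ f m h y c → f * m * (h * y) + y * (c * f) ≡ (m * h + c) * (y * f)
    collect = solve-∀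

  eNum≤[1+1/L]^[1+L] : ∀ L n → eNum n * L ^ suc L ≤ suc L ^ suc L * eDen n
  eNum≤[1+1/L]^[1+L] L zero    = z≤n
  eNum≤[1+1/L]^[1+L] L (suc n) = *-cancelʳ-≤ _ _ (M ^ n) {{m^n≢0 M n}} (begin
    x * L ^ M * M ^ n                ≡⟨ xy∙z≈y∙xz x (L ^ M) (M ^ n) ⟩
    L ^ M * (x * M ^ n)              ≤⟨ *-monoʳ-≤ (L ^ M) (eNum≤negBinom M n) ⟩
    L ^ M * (negBinom M M n * y)     ≡⟨ *-assoc (L ^ M) _ y ⟨
    L ^ M * negBinom M M n * y       ≤⟨ *-monoˡ-≤ y (negBinom-bound L M n) ⟩
    M ^ (M + n) * y                  ≡⟨ cong (_* y) (^-distribˡ-+-* M M n) ⟩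
    M ^ M * M ^ n * y                ≡⟨ xy∙z≈xz∙y (M ^ M) (M ^ n) y ⟩
    M ^ M * y * M ^ n                ∎)
    where
    M = suc L
    x = eNum (suc n)
    y = eDen (suc n)

  eNum≤[1+1/r]^[1+r+d] : ∀ n r d → eNum n * r ^ (suc r + d) ≤ suc r ^ (suc r + d) * eDen n
  eNum≤[1+1/r]^[1+r+d] n r d = begin
    X * r ^ (M + d)           ≡⟨ cong (X *_) (^-distribˡ-+-* r M d) ⟩
    X * (r ^ M * r ^ d)       ≤⟨ *-monoʳ-≤ X (*-monoʳ-≤ (r ^ M) (^-monoˡ-≤ d (n≤1+n r))) ⟩
    X * (r ^ M * M ^ d)       ≡⟨ *-assoc X (r ^ M) (M ^ d) ⟨
    X * r ^ M * M ^ d         ≤⟨ *-monoˡ-≤ (M ^ d) (eNum≤[1+1/L]^[1+L] r n) ⟩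
    M ^ M * Y * M ^ d         ≡⟨ xy∙z≈xz∙y (M ^ M) Y (M ^ d) ⟩
    M ^ M * M ^ d * Y         ≡⟨ cong (_* Y) (^-distribˡ-+-* M M d) ⟨
    M ^ (M + d) * Y           ∎
    where
    M = suc r
    X = eNum n
    Y = eDen n

  eNum^q≤[1+q/s]^[s+q] : ∀ n q s → eNum n ^ q * s ^ (s + q) ≤ (s + q) ^ (s + q) * eDen n ^ q
  eNum^q≤[1+q/s]^[s+q] n zero    s rewrite +-identityʳ s = ≤-reflexive (trans (*-identityˡ _) (sym (*-identityʳ _)))
  eNum^q≤[1+q/s]^[s+q] n (suc q) s rewrite +-suc s q = begin
    X * X ^ q * s ^ suc (s + q)          ≡⟨ xy∙z≈y∙xz X (X ^ q) _ ⟩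
    X ^ q * (X * s ^ (suc s + q))        ≤⟨ *-monoʳ-≤ (X ^ q) (eNum≤[1+1/r]^[1+r+d] n s q) ⟩
    X ^ q * (suc s ^ (suc s + q) * Y)    ≡⟨ *-assoc (X ^ q) _ Y ⟨
    X ^ q * suc s ^ (suc s + q) * Y      ≤⟨ *-monoˡ-≤ Y (eNum^q≤[1+q/s]^[s+q] n q (suc s)) ⟩
    P * Y ^ q * Y                        ≡⟨ *-assoc P (Y ^ q) Y ⟩
    P * (Y ^ q * Y)                      ≡⟨ cong (P *_) (*-comm (Y ^ q) Y) ⟩
    P * (Y * Y ^ q)                      ∎
    where
    X = eNum n
    Y = eDen n
    P = suc (s + q) ^ suc (s + q)

  ^-distribʳ-* : ∀ a b k → (a * b) ^ k ≡ a ^ k * b ^ k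
  ^-distribʳ-* a b zero    = refl
  ^-distribʳ-* a b (suc k) = trans (cong ((a * b) *_) (^-distribʳ-* a b k)) (*-*-interchange a b (a ^ k) (b ^ k))
    where
    *-*-interchange : ∀ a b c d → a * b * (c * d) ≡ a * c * (b * d)
    *-*-interchange = solve-∀

  ^-swap : ∀ a b c → (a ^ b) ^ c ≡ (a ^ c) ^ b
  ^-swap a b c = trans (^-*-assoc a b c) (trans (cong (a ^_) (*-comm b c)) (sym (^-*-assoc a c b)))

  eNum^kq≤N^[s+q] : ∀ n {N s} q k .{{_ : NonZero s}} → (s + q) ^ k ≤ N * s ^ k →
                    eNum n ^ (k * q) ≤ N ^ (s + q) * eDen n ^ (k * q)
  eNum^kq≤N^[s+q] n {N} {s} q k hyp = *-cancelʳ-≤ _ _ ((s ^ k) ^ p) {{m^n≢0 (s ^ k) p {{m^n≢0 s k}}}} (begin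
    X ^ (k * q) * (s ^ k) ^ p     ≡⟨ cong₂ _*_ (trans (sym (^-*-assoc X k q)) (^-swap X k q)) (^-swap s k p) ⟩
    (X ^ q) ^ k * (s ^ p) ^ k     ≡⟨ ^-distribʳ-* (X ^ q) (s ^ p) k ⟨
    (X ^ q * s ^ p) ^ k           ≤⟨ ^-monoˡ-≤ k (eNum^q≤[1+q/s]^[s+q] n q s) ⟩
    (p ^ p * Y ^ q) ^ k           ≡⟨ ^-distribʳ-* (p ^ p) (Y ^ q) k ⟩
    (p ^ p) ^ k * (Y ^ q) ^ k     ≡⟨ cong₂ _*_ (^-swap p p k) (trans (^-swap Y q k) (^-*-assoc Y k q)) ⟩
    (p ^ k) ^ p * Y ^ (k * q)     ≤⟨ *-monoˡ-≤ (Y ^ (k * q)) (^-monoˡ-≤ p hyp) ⟩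
    (N * s ^ k) ^ p * Y ^ (k * q) ≡⟨ cong (_* Y ^ (k * q)) (^-distribʳ-* N (s ^ k) p) ⟩
    N ^ p * (s ^ k) ^ p * Y ^ (k * q) ≡⟨ xy∙z≈xz∙y (N ^ p) _ _ ⟩
    N ^ p * Y ^ (k * q) * (s ^ k) ^ p ∎)
    where
    X = eNum n
    Y = eDen n
    p = s + q

  -- When p ≤ q the truncated p ∸ q is 0 and the hypothesis forces k = 0.
  eNum^kq≤N^p : ∀ n {N p q} k .{{_ : NonZero p}} → p ^ k ≤ N * (p ∸ q) ^ k →
              eNum n ^ (k * q) ≤ N ^ p * eDen n ^ (k * q)
  eNum^kq≤N^p n {N} {p} {q} k hyp with p ∸ q in p∸q≡
  eNum^kq≤N^p n {N} {p} zero    hyp | zero = *-monoˡ-≤ 1 (m^n>0 N p)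
    where instance _ = >-nonZero (≤-trans hyp (≤-reflexive (*-identityʳ N)))
  eNum^kq≤N^p n {N} {p} (suc k) hyp | zero =
    contradiction (≤-trans (m^n>0 p (suc k)) (≤-trans hyp (≤-reflexive (*-zeroʳ N)))) λ ()
  eNum^kq≤N^p n {N} {p} {q} k   hyp | suc s =
    subst (λ p → eNum n ^ (k * q) ≤ N ^ p * eDen n ^ (k * q)) p≡
      (eNum^kq≤N^[s+q] n {N} q k (subst (λ p → p ^ k ≤ N * suc s ^ k) (sym p≡) hyp))
    where
    p≡ : suc s + q ≡ p
    p≡ = trans (cong (_+ q) (sym p∸q≡)) (m∸n+n≡m {p} {q} (<⇒≤ (m∸n≢0⇒n<m {p} {q} p∸q≢0)))
      where
      p∸q≢0 : p ∸ q ≢ 0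
      p∸q≢0 p∸q≡0 = 0≢1+n (trans (sym p∸q≡0) p∸q≡)

module Fractions where

  open EulerBound using (eNum; eDen; eDen≢0)
  open import Data.Nat as ℕ using (zero; suc; NonZero; _!)
  open import Data.Nat.Properties as ℕ using (m*n≢0; m^n≢0; _!≢0)
  open import Data.Integer as ℤ using (+_)
  open import Data.Integer.Properties using (pos-*; pos-+; drop‿+≤+)
  open import Data.List using ([]; _∷_; foldr)
  open import Data.List.Membership.Propositional using (_∈_)
  open import Data.List.Relation.Unary.Any using (here; there)
  open import Data.Rational using (ℚ; mkℚ; 0ℚ; _/_; toℚᵘ; _≤_; *≤*; _+_; _*_; _⊔_; ↥_; ↧ₙ_)
  open import Data.Rational.Properties
    using ( toℚᵘ-fromℚᵘ; toℚᵘ-mono-≤; toℚᵘ-cancel-≤; toℚᵘ-injective; toℚᵘ-homo-+; toℚᵘ-homo-*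
          ; /-cong; p≤p⊔q; p≤q⊔p; ≤-refl; ≤-trans; module ≤-Reasoning)
  open import Data.Rational.Unnormalised as ℚᵘ using (_≃_) renaming (_/_ to _/ᵘ_)
  open import Data.Rational.Unnormalised.Properties as ℚᵘ
    using (≃-sym; ≤-respˡ-≃; ≤-respʳ-≃; module ≃-Reasoning)
  open import Relation.Binary.PropositionalEquality

  toℚᵘ-/ : ∀ a b .{{_ : NonZero b}} → toℚᵘ (+ a / b) ≃ + a /ᵘ b
  toℚᵘ-/ a (suc b) = toℚᵘ-fromℚᵘ (ℚᵘ.mkℚᵘ (+ a) b)

  /-mono-≤ : ∀ a b c d .{{_ : NonZero b}} .{{_ : NonZero d}} → a ℕ.* d ℕ.≤ c ℕ.* b → + a / b ≤ + c / d
  /-mono-≤ a b@(suc _) c d@(suc _) ad≤cb = toℚᵘ-cancel-≤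
    (≤-respˡ-≃ (≃-sym (toℚᵘ-/ a b)) (≤-respʳ-≃ (≃-sym (toℚᵘ-/ c d))
      (ℚᵘ.*≤* (subst₂ ℤ._≤_ (pos-* a d) (pos-* c b) (ℤ.+≤+ ad≤cb)))))

  /-*-/ : ∀ a b c d .{{_ : NonZero b}} .{{_ : NonZero d}} →
          (+ a / b) * (+ c / d) ≡ (+ (a ℕ.* c) / (b ℕ.* d)) {{m*n≢0 b d}}
  /-*-/ a b@(suc _) c d@(suc _) = toℚᵘ-injective (begin
    toℚᵘ ((+ a / b) * (+ c / d))           ≈⟨ toℚᵘ-homo-* (+ a / b) (+ c / d) ⟩
    toℚᵘ (+ a / b) ℚᵘ.* toℚᵘ (+ c / d) ≈⟨ ℚᵘ.*-cong (toℚᵘ-/ a b) (toℚᵘ-/ c d) ⟩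
    (+ a ℤ.* + c) /ᵘ (b ℕ.* d)         ≡⟨ cong (_/ᵘ (b ℕ.* d)) (pos-* a c) ⟨
    + (a ℕ.* c) /ᵘ (b ℕ.* d)           ≈⟨ toℚᵘ-/ (a ℕ.* c) (b ℕ.* d) ⟨
    toℚᵘ (+ (a ℕ.* c) / (b ℕ.* d))     ∎)
    where open ≃-Reasoning

  /-+-/ : ∀ a b c d .{{_ : NonZero b}} .{{_ : NonZero d}} →
          + a / b + + c / d ≡ (+ (a ℕ.* d ℕ.+ c ℕ.* b) / (b ℕ.* d)) {{m*n≢0 b d}}
  /-+-/ a b@(suc _) c d@(suc _) = toℚᵘ-injective (begin
    toℚᵘ (+ a / b + + c / d)                    ≈⟨ toℚᵘ-homo-+ (+ a / b) (+ c / d) ⟩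
    toℚᵘ (+ a / b) ℚᵘ.+ toℚᵘ (+ c / d)          ≈⟨ ℚᵘ.+-cong (toℚᵘ-/ a b) (toℚᵘ-/ c d) ⟩
    (+ a ℤ.* + d ℤ.+ + c ℤ.* + b) /ᵘ (b ℕ.* d)  ≡⟨ cong (_/ᵘ (b ℕ.* d)) numerator ⟩
    + (a ℕ.* d ℕ.+ c ℕ.* b) /ᵘ (b ℕ.* d)        ≈⟨ toℚᵘ-/ (a ℕ.* d ℕ.+ c ℕ.* b) (b ℕ.* d) ⟨
    toℚᵘ (+ (a ℕ.* d ℕ.+ c ℕ.* b) / (b ℕ.* d))  ∎)
    where
    open ≃-Reasoning
    numerator : + a ℤ.* + d ℤ.+ + c ℤ.* + b ≡ + (a ℕ.* d ℕ.+ c ℕ.* b)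
    numerator = trans (cong₂ ℤ._+_ (sym (pos-* a d)) (sym (pos-* c b))) (sym (pos-+ (a ℕ.* d) (c ℕ.* b)))

  /-^ℚ : ∀ a b .{{_ : NonZero b}} k → (+ a / b) ^ℚ k ≡ (+ (a ℕ.^ k) / (b ℕ.^ k)) {{m^n≢0 b k}}
  /-^ℚ a b zero    = refl
  /-^ℚ a b {{b≢0}} (suc k) =
    trans (cong (+ a / b *_) (/-^ℚ a b k)) (/-*-/ a b (a ℕ.^ k) (b ℕ.^ k) {{b≢0}} {{m^n≢0 b k}})

  eApprox≡eNum/eDen : ∀ n → eApprox n ≡ (+ eNum n / eDen n) {{eDen≢0 n}}
  eApprox≡eNum/eDen zero    = refl
  eApprox≡eNum/eDen (suc n) = begin
    eApprox n + + 1 / n !                                  ≡⟨ cong (_+ + 1 / n !) (eApprox≡eNum/eDen n) ⟩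
    + eNum n / eDen n + + 1 / n !                          ≡⟨ /-+-/ (eNum n) (eDen n) 1 (n !) {{eDen≢0 n}} {{n !≢0}} ⟩
    + (eNum n ℕ.* n ! ℕ.+ 1 ℕ.* eDen n) / (eDen n ℕ.* n !)
      ≡⟨ /-cong (cong (λ y → + (eNum n ℕ.* n ! ℕ.+ y)) (ℕ.*-identityˡ (eDen n))) refl ⟩
    + eNum (suc n) / eDen (suc n)                          ∎
    where
    open ≡-Reasoning
    instance
      _ = eDen≢0 n
      _ = n !≢0
      _ = eDen≢0 (suc n)

  LeLnTimes-intro : ∀ k N D →
    (∀ n → eNum n ℕ.^ (k ℕ.* ↧ₙ D) ℕ.≤ N ℕ.^ ℤ.∣ ↥ D ∣ ℕ.* eDen n ℕ.^ (k ℕ.* ↧ₙ D)) →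
    LeLnTimes k N D
  LeLnTimes-intro k N D bound n = begin
    eApprox n ^ℚ e                  ≡⟨ cong (_^ℚ e) (eApprox≡eNum/eDen n) ⟩
    (+ eNum n / eDen n) ^ℚ e        ≡⟨ /-^ℚ (eNum n) (eDen n) e ⟩
    + (eNum n ℕ.^ e) / eDen n ℕ.^ e ≤⟨ /-mono-≤ (eNum n ℕ.^ e) (eDen n ℕ.^ e) (N ℕ.^ p) (1 ℕ.^ p) cross ⟩
    + (N ℕ.^ p) / 1 ℕ.^ p           ≡⟨ /-^ℚ N 1 p ⟨
    fromℕℚ N ^ℚ p                   ∎
    where
    open ≤-Reasoning
    e = k ℕ.* ↧ₙ D
    p = ℤ.∣ ↥ D ∣
    instance
      _ = eDen≢0 n
      _ = m^n≢0 (eDen n) e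
      _ = m^n≢0 1 p
    cross : eNum n ℕ.^ e ℕ.* 1 ℕ.^ p ℕ.≤ N ℕ.^ p ℕ.* eDen n ℕ.^ e
    cross = ℕ.≤-trans (ℕ.≤-reflexive (trans (cong (eNum n ℕ.^ e ℕ.*_) (ℕ.^-zeroˡ p)) (ℕ.*-identityʳ _))) (bound n)

  LeLnTimes-zero : ∀ N D .{{_ : NonZero N}} → LeLnTimes 0 N D
  LeLnTimes-zero N D = LeLnTimes-intro 0 N D λ n → ℕ.*-monoˡ-≤ 1 (ℕ.m^n>0 N ℤ.∣ ↥ D ∣)

  frac≤⇒* : ∀ a μ {D} → 0ℚ ≤ D → frac a (suc μ) ≤ D → a ℕ.* ↧ₙ D ℕ.≤ suc μ ℕ.* ℤ.∣ ↥ D ∣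
  frac≤⇒* a μ {mkℚ ℤ.-[1+ _ ] _ _} (*≤* ()) _
  frac≤⇒* a μ {mkℚ (+ n) d _}      _ a/μ≤D with ≤-respˡ-≃ (toℚᵘ-/ a (suc μ)) (toℚᵘ-mono-≤ a/μ≤D)
  ... | ℚᵘ.*≤* cross =
    ℕ.≤-trans (drop‿+≤+ (subst₂ ℤ._≤_ (sym (pos-* a (suc d))) (sym (pos-* n (suc μ))) cross))
              (ℕ.≤-reflexive (ℕ.*-comm n (suc μ)))

  module _ {X : Set} (f : X → ℚ) where

    ≤-foldr-⊔ : ∀ {x xs} → x ∈ xs → f x ≤ foldr (λ y acc → f y ⊔ acc) 0ℚ xs
    ≤-foldr-⊔ {xs = y ∷ xs} (here refl)  = p≤p⊔q (f y) _
    ≤-foldr-⊔ {xs = y ∷ xs} (there x∈xs) = ≤-trans (≤-foldr-⊔ x∈xs) (p≤q⊔p (f y) _)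

    0≤foldr-⊔ : ∀ xs → 0ℚ ≤ foldr (λ y acc → f y ⊔ acc) 0ℚ xs
    0≤foldr-⊔ []       = ≤-refl
    0≤foldr-⊔ (y ∷ xs) = ≤-trans (0≤foldr-⊔ xs) (p≤q⊔p (f y) _)

module SpecifyingSets where

  open import Data.Bool using (true; false; if_then_else_; not; T)
  open import Data.Bool.Properties using (T-≡; not-¬; ¬-not) renaming (_≟_ to _≟B_)
  open import Data.Nat
  open import Data.Nat.Properties
  open import Data.Fin using (Fin; zero; suc) renaming (_≟_ to _≟F_)
  open import Data.Fin.Subset using (Subset; ∣_∣; ⊥)
  open import Data.Fin.Subset.Properties using (∣p∣≤∣x∷p∣)
  open import Data.Vec using ([]; _∷_; lookup; _[_]≔_)
  open import Data.Vec.Properties using (lookup∘update; lookup∘update′; lookup-replicate)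
  open import Data.List using (_∷_; map; filter; foldr; allFin)
  open import Data.List.Properties using (filter-all; filter-some; filter-≐)
  open import Data.List.Relation.Unary.All as All using (_∷_)
  open import Data.List.Relation.Unary.All.Properties using (all⁺; all⁻)
  open import Data.List.Relation.Unary.Any using (here; there)
  open import Data.List.Relation.Unary.AllPairs using (_∷_)
  open import Data.List.Membership.Propositional using (_∈_; lose)
  open import Data.List.Membership.Propositional.Properties using (∈-++⁺ˡ; ∈-++⁺ʳ; ∈-map⁺; ∈-allFin)
  open import Data.Product using (_×_; _,_; ∃-syntax)
  open import Data.Sum using (_⊎_; inj₁; inj₂; [_,_]′)
  open import Function using (_∘_; Equivalence)
  open import Relation.Binary.Definitions using (DecidableEquality)
  open import Relation.Binary.PropositionalEquality
  open import Relation.Nullary using (yes; no; contradiction)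
  open import Relation.Nullary.Decidable using (⌊_⌋; toWitness; fromWitness)
  open import Relation.Unary using (Pred; Decidable)
  open import Relation.Unary.Properties using (_∩?_)

  allVecs-complete : ∀ {m} (v : Vec Bool m) → v ∈ allVecs m
  allVecs-complete []          = here refl
  allVecs-complete (false ∷ v) = ∈-++⁺ˡ (∈-map⁺ (false ∷_) (allVecs-complete v))
  allVecs-complete {suc m} (true ∷ v) = ∈-++⁺ʳ (map (false ∷_) (allVecs m)) (∈-map⁺ (true ∷_) (allVecs-complete v))

  filter∈sublists : ∀ {X : Set} {p} {P : Pred X p} (P? : Decidable P) xs → filter P? xs ∈ sublists xs
  filter∈sublists P? []       = here refl
  filter∈sublists P? (x ∷ xs) with P? x
  ... | no  _ = ∈-++⁺ˡ (filter∈sublists P? xs)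
  ... | yes _ = ∈-++⁺ʳ (sublists xs) (∈-map⁺ (x ∷_) (filter∈sublists P? xs))

  filter-∩? : ∀ {X : Set} {q r} {Q : Pred X q} {R : Pred X r} (Q? : Decidable Q) (R? : Decidable R) xs →
              filter (Q? ∩? R?) xs ≡ filter R? (filter Q? xs)
  filter-∩? Q? R? []       = refl
  filter-∩? Q? R? (x ∷ xs) with Q? x
  ... | no  _ = filter-∩? Q? R? xs
  ... | yes _ with R? x
  ...   | yes _ = cong (x ∷_) (filter-∩? Q? R? xs)
  ...   | no  _ = filter-∩? Q? R? xs

  lookup-≢ : ∀ {X : Set} {m} → DecidableEquality X → (x y : Vec X m) → x ≢ y → ∃[ j ] lookup x j ≢ lookup y j
  lookup-≢ _≟_ []      []      x≢y = contradiction refl x≢y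
  lookup-≢ _≟_ (a ∷ x) (b ∷ y) x≢y with a ≟ b
  ... | no a≢b  = zero , a≢b
  ... | yes refl with lookup-≢ _≟_ x y (x≢y ∘ cong (a ∷_))
  ...   | j , xj≢yj = suc j , xj≢yj

  Agrees : ∀ {m} → Subset m → Cube m → Cube m → Set
  Agrees S h a = ∀ i → lookup S i ≡ true → lookup a i ≡ lookup h i

  module _ {m} (S h a : Cube m) where

    private
      agreesAt : Fin m → Bool
      agreesAt i = if lookup S i then ⌊ lookup a i ≟B lookup h i ⌋ else true

    agreesOn-sound : agreesOn S h a ≡ true → Agrees S h a
    agreesOn-sound agree i = at i (All.lookup (all⁺ agreesAt (allFin m) (Equivalence.from T-≡ agree)) (∈-allFin i))
      where
      at : ∀ i → T (agreesAt i) → lookup S i ≡ true → lookup a i ≡ lookup h i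
      at i t Si with lookup S i
      at i t refl | true = toWitness t

    agreesOn-complete : Agrees S h a → agreesOn S h a ≡ true
    agreesOn-complete agree = Equivalence.to T-≡ (all⁻ agreesAt {allFin m} (All.tabulate λ {i} _ → at i))
      where
      at : ∀ i → T (agreesAt i)
      at i with lookup S i in Si
      ... | false = _
      ... | true  = fromWitness (agree i Si)

  module _ {m} (S h a : Cube m) (j : Fin m) where

    Agrees-≔⁻ : Agrees (S [ j ]≔ true) h a → Agrees S h a × lookup a j ≡ lookup h j
    Agrees-≔⁻ agree = (λ i Si → agree i (≔-keeps i Si)) , agree j (lookup∘update j S true)
      where
      ≔-keeps : ∀ i → lookup S i ≡ true → lookup (S [ j ]≔ true) i ≡ true
      ≔-keeps i Si with i ≟F j
      ... | yes refl = lookup∘update j S true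
      ... | no  i≢j  = trans (lookup∘update′ i≢j S true) Si

    Agrees-≔⁺ : Agrees S h a × lookup a j ≡ lookup h j → Agrees (S [ j ]≔ true) h a
    Agrees-≔⁺ (agree , aj≡hj) i S′i with i ≟F j
    ... | yes refl = aj≡hj
    ... | no  i≢j  = agree i (trans (sym (lookup∘update′ i≢j S true)) S′i)

  ∣≔true∣≤ : ∀ {m} (S : Subset m) j → ∣ S [ j ]≔ true ∣ ≤ suc ∣ S ∣
  ∣≔true∣≤ (s ∷ S)     zero    = s≤s (∣p∣≤∣x∷p∣ s S)
  ∣≔true∣≤ (false ∷ S) (suc j) = ∣≔true∣≤ S j
  ∣≔true∣≤ (true ∷ S)  (suc j) = s≤s (∣≔true∣≤ S j)

  matching : ∀ {m} → List (Cube m) → Cube m → Subset m → List (Cube m)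
  matching A h S = filter (λ a → agreesOn S h a ≟B true) A

  matching-⊥ : ∀ {m} (A : List (Cube m)) h → matching A h ⊥ ≡ A
  matching-⊥ A h = filter-all (λ a → agreesOn ⊥ h a ≟B true)
    (All.tabulate λ {a} _ → agreesOn-complete ⊥ h a λ i ⊥i →
      contradiction (trans (sym (lookup-replicate i false)) ⊥i) λ ())

  matching-≔ : ∀ {m} (A : List (Cube m)) h S j →
    matching A h (S [ j ]≔ true) ≡ filter (λ b → lookup b j ≟B lookup h j) (matching A h S)
  matching-≔ A h S j =
    trans (filter-≐ agree′? (agree? ∩? coord?) ((λ {a} → ⊆ {a}) , λ {a} → ⊇ {a}) A) (filter-∩? agree? coord? A)
    where
    agree′? = λ a → agreesOn (S [ j ]≔ true) h a ≟B true
    agree?  = λ a → agreesOn S h a ≟B true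
    coord?  = λ a → lookup a j ≟B lookup h j
    ⊆ : ∀ {a} → agreesOn (S [ j ]≔ true) h a ≡ true → agreesOn S h a ≡ true × lookup a j ≡ lookup h j
    ⊆ {a} S′a with Agrees-≔⁻ S h a j (agreesOn-sound (S [ j ]≔ true) h a S′a)
    ... | Sa , aj = agreesOn-complete S h a Sa , aj
    ⊇ : ∀ {a} → agreesOn S h a ≡ true × lookup a j ≡ lookup h j → agreesOn (S [ j ]≔ true) h a ≡ true
    ⊇ {a} (Sa , aj) = agreesOn-complete (S [ j ]≔ true) h a (Agrees-≔⁺ S h a j (agreesOn-sound S h a Sa , aj))

  countAt-split : ∀ {m} (B : List (Cube m)) j ξ → countAt B j ξ + countAt B j (not ξ) ≡ length B
  countAt-split []      j ξ = refl
  countAt-split (b ∷ B) j ξ with lookup b j ≟B ξ | lookup b j ≟B not ξ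
  ... | yes bj≡ξ | yes bj≡¬ξ = contradiction bj≡¬ξ (not-¬ bj≡ξ)
  ... | yes _    | no  _     = cong suc (countAt-split B j ξ)
  ... | no  _    | yes _     = trans (+-suc _ _) (cong suc (countAt-split B j ξ))
  ... | no bj≢ξ  | no bj≢¬ξ  = contradiction (¬-not bj≢ξ) bj≢¬ξ

  countAt-pos : ∀ {m} (B : List (Cube m)) {b} j {ξ} → b ∈ B → lookup b j ≡ ξ → 1 ≤ countAt B j ξ
  countAt-pos B j {ξ} b∈B bj≡ξ = filter-some (λ b → lookup b j ≟B ξ) (lose b∈B bj≡ξ)

  minCount : ∀ {m} → List (Cube m) → Fin m → ℕ
  minCount B j = countAt B j false ⊓ countAt B j true

  module _ {X : Set} (f : X → ℕ) where

    ≤-foldr-⊔ : ∀ {x xs} → x ∈ xs → f x ≤ foldr (λ y acc → f y ⊔ acc) 0 xs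
    ≤-foldr-⊔ {xs = y ∷ xs} (here refl)  = m≤m⊔n (f y) _
    ≤-foldr-⊔ {xs = y ∷ xs} (there x∈xs) = ≤-trans (≤-foldr-⊔ x∈xs) (m≤n⊔m (f y) _)

    foldr-⊔-attained : ∀ xs → let max = foldr (λ y acc → f y ⊔ acc) 0 xs in max ≡ 0 ⊎ ∃[ x ] max ≡ f x
    foldr-⊔-attained []       = inj₁ refl
    foldr-⊔-attained (y ∷ xs) with ⊔-sel (f y) (foldr (λ y acc → f y ⊔ acc) 0 xs)
    ... | inj₁ max≡fy   = inj₂ (y , max≡fy)
    ... | inj₂ max≡rest with foldr-⊔-attained xs
    ...   | inj₁ rest≡0          = inj₁ (trans max≡rest rest≡0)
    ...   | inj₂ (x , rest≡fx)   = inj₂ (x , trans max≡rest rest≡fx)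

  MAMI-pos : ∀ {m} {B : List (Cube m)} → Unique B → 2 ≤ length B → 1 ≤ MAMI B
  MAMI-pos {B = _ ∷ []}    _ (s≤s ())
  MAMI-pos {B = x ∷ y ∷ B} ((x≢y ∷ _) ∷ _) _ with lookup-≢ _≟B_ x y x≢y
  ... | j , xj≢yj =
    ≤-trans (⊓-glb (both-sides false) (both-sides true)) (≤-foldr-⊔ (minCount (x ∷ y ∷ B)) (∈-allFin j))
    where
    both-sides : ∀ ξ → 1 ≤ countAt (x ∷ y ∷ B) j ξ
    both-sides ξ = [ countAt-pos (x ∷ y ∷ B) j (here refl) , countAt-pos (x ∷ y ∷ B) j (there (here refl)) ]′ (cover ξ)
      where
      cover : ∀ ξ → lookup x j ≡ ξ ⊎ lookup y j ≡ ξ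
      cover ξ with lookup x j ≟B ξ | lookup y j ≟B ξ
      ... | yes xj≡ξ | _        = inj₁ xj≡ξ
      ... | no  _    | yes yj≡ξ = inj₂ yj≡ξ
      ... | no  xj≢ξ | no  yj≢ξ = contradiction (trans (¬-not xj≢ξ) (sym (¬-not yj≢ξ))) xj≢yj

  MAMI-split : ∀ {m} {B : List (Cube m)} → Unique B → 2 ≤ length B →
               ∃[ j ] ∀ ξ → countAt B j ξ + MAMI B ≤ length B
  MAMI-split {m} {B} B-unique 2≤∣B∣ with foldr-⊔-attained (minCount B) (allFin m)
  ... | inj₁ MAMI≡0      = contradiction (subst (1 ≤_) MAMI≡0 (MAMI-pos B-unique 2≤∣B∣)) λ ()
  ... | inj₂ (j , MAMI≡) = j , λ ξ → begin
    countAt B j ξ + MAMI B              ≡⟨ cong (countAt B j ξ +_) MAMI≡ ⟩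
    countAt B j ξ + minCount B j        ≤⟨ +-monoʳ-≤ (countAt B j ξ) (minCount≤ ξ) ⟩
    countAt B j ξ + countAt B j (not ξ) ≡⟨ countAt-split B j ξ ⟩
    length B                            ∎
    where
    open ≤-Reasoning
    minCount≤ : ∀ ξ → minCount B j ≤ countAt B j (not ξ)
    minCount≤ false = m⊓n≤n _ _
    minCount≤ true  = m⊓n≤m _ _

  ETDh-≤ : ∀ {m} (A : List (Cube m)) h S → IsSpecifying A h S → ETDh A h ≤ ∣ S ∣
  ETDh-≤ {m} A h S S-spec = go (allVecs m) (allVecs-complete S)
    where
    go : ∀ Ss → S ∈ Ss → foldr (λ S acc → if ⌊ matchCount A h S ≤? 1 ⌋ then ∣ S ∣ ⊓ acc else acc) m Ss ≤ ∣ S ∣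
    go (S′ ∷ Ss) S∈ with matchCount A h S′ ≤? 1 | S∈
    ... | yes _      | here refl  = m⊓n≤m _ _
    ... | yes _      | there S∈Ss = ≤-trans (m⊓n≤n _ _) (go Ss S∈Ss)
    ... | no ¬S-spec | here refl  = contradiction S-spec ¬S-spec
    ... | no _       | there S∈Ss = go Ss S∈Ss

  ≢[]⇒length≢0 : ∀ {X : Set} {xs : List X} → xs ≢ [] → NonZero (length xs)
  ≢[]⇒length≢0 {xs = []}    xs≢[] = contradiction refl xs≢[]
  ≢[]⇒length≢0 {xs = _ ∷ _} _     = _

module Greedy where

  open SpecifyingSets
  open import Data.Bool using (true)
  open import Data.Nat
  open import Data.Nat.Properties
  open import Data.Fin.Subset using (∣_∣)
  open import Data.Vec using (lookup; _[_]≔_)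
  open import Data.List.Membership.Propositional using (_∈_)
  import Data.List.Relation.Unary.Unique.Propositional.Properties as Unique
  open import Data.Product using (_×_; _,_; ∃-syntax)
  open import Data.Sum using (_⊎_; inj₁; inj₂)
  open import Relation.Binary.PropositionalEquality
  open import Relation.Nullary using (yes; no; contradiction)

  m*n≤o*p⇒p≢0 : ∀ {m n o p} .{{_ : NonZero m}} .{{_ : NonZero n}} → m * n ≤ o * p → NonZero p
  m*n≤o*p⇒p≢0 {m} {n} {o} {zero} mn≤0 =
    contradiction (n≤0⇒n≡0 (≤-trans mn≤0 (≤-reflexive (*-zeroʳ o)))) (≢-nonZero⁻¹ (m * n) {{m*n≢0 m n}})
  m*n≤o*p⇒p≢0 {p = suc _} _ = _

  contraction : ∀ {c c′ μ p q} → c′ + μ ≤ c → (c ∸ 1) * q ≤ μ * p → p * (c′ ∸ 1) ≤ (c ∸ 1) * (p ∸ q)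
  contraction {c} {c′} {μ} {p} {q} c′+μ≤c cq≤μp = begin
    p * (c′ ∸ 1)          ≤⟨ *-monoʳ-≤ p (∸-monoˡ-≤ 1 (m+n≤o⇒m≤o∸n c′ c′+μ≤c)) ⟩
    p * (c ∸ μ ∸ 1)       ≡⟨ cong (p *_) (∸-comm c μ 1) ⟩
    p * (c ∸ 1 ∸ μ)       ≡⟨ *-distribˡ-∸ p (c ∸ 1) μ ⟩
    p * (c ∸ 1) ∸ p * μ   ≤⟨ ∸-monoʳ-≤ (p * (c ∸ 1)) qc≤pμ ⟩
    p * (c ∸ 1) ∸ q * (c ∸ 1) ≡⟨ *-distribʳ-∸ (c ∸ 1) p q ⟨
    (p ∸ q) * (c ∸ 1)     ≡⟨ *-comm (p ∸ q) (c ∸ 1) ⟩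
    (c ∸ 1) * (p ∸ q)     ∎
    where
    open ≤-Reasoning
    qc≤pμ : q * (c ∸ 1) ≤ p * μ
    qc≤pμ = ≤-trans (≤-reflexive (*-comm q (c ∸ 1))) (≤-trans cq≤μp (≤-reflexive (*-comm μ p)))
    ∸-comm : ∀ m n o → m ∸ n ∸ o ≡ m ∸ o ∸ n
    ∸-comm m n o = trans (∸-+-assoc m n o) (trans (cong (m ∸_) (+-comm n o)) (sym (∸-+-assoc m o n)))

  module _ {m} (A : List (Cube m)) (A-unique : Unique A) (h : Cube m) {p q : ℕ} .{{_ : NonZero q}}
                (density-bound : ∀ {B} → B ∈ sublists A → 1 ≤ MAMI B → (length B ∸ 1) * q ≤ MAMI B * p) where

    greedy-step : ∀ S → 2 ≤ matchCount A h S →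
           ∃[ j ] (NonZero p × p * (matchCount A h (S [ j ]≔ true) ∸ 1) ≤ (matchCount A h S ∸ 1) * (p ∸ q))
    greedy-step S 2≤c with MAMI-split (Unique.filter⁺ _ A-unique) 2≤c
    ... | j , split =
      j , m*n≤o*p⇒p≢0 {c ∸ 1} {q} {MAMI B} B-dense , contraction {c} {matchCount A h (S [ j ]≔ true)} c′+μ≤c B-dense
      where
      B = matching A h S
      c = length B
      instance _ = >-nonZero (∸-monoˡ-≤ 1 2≤c)
      B-dense : (c ∸ 1) * q ≤ MAMI B * p
      B-dense = density-bound (filter∈sublists _ A) (MAMI-pos (Unique.filter⁺ _ A-unique) 2≤c)
      c′+μ≤c : matchCount A h (S [ j ]≔ true) + MAMI B ≤ c
      c′+μ≤c = subst (λ B′ → length B′ + MAMI B ≤ c) (sym (matching-≔ A h S j)) (split (lookup h j))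

    greedy : ∀ k S → ETDh A h ≤ ∣ S ∣ + k ⊎ (NonZero p × p ^ k ≤ (matchCount A h S ∸ 1) * (p ∸ q) ^ k)
    greedy k S with matchCount A h S ≤? 1
    ... | yes S-spec = inj₁ (≤-trans (ETDh-≤ A h S S-spec) (m≤m+n ∣ S ∣ k))
    ... | no ¬S-spec with greedy-step S (≰⇒> ¬S-spec)
    greedy zero    S | no ¬S-spec | _ , p≢0 , _ =
      inj₂ (p≢0 , ≤-trans (∸-monoˡ-≤ 1 (≰⇒> ¬S-spec)) (≤-reflexive (sym (*-identityʳ _))))
    greedy (suc k) S | no _       | j , p≢0 , shrunk with greedy k (S [ j ]≔ true)
    ... | inj₁ done = inj₁ (begin
      ETDh A h                  ≤⟨ done ⟩
      ∣ (S [ j ]≔ true) ∣ + k    ≤⟨ +-monoˡ-≤ k (∣≔true∣≤ S j) ⟩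
      suc ∣ S ∣ + k             ≡⟨ +-suc ∣ S ∣ k ⟨
      ∣ S ∣ + suc k             ∎)
      where open ≤-Reasoning
    ... | inj₂ (_ , bound) = inj₂ (p≢0 , (begin
      p * p ^ k                        ≤⟨ *-monoʳ-≤ p bound ⟩
      p * ((c′ ∸ 1) * r ^ k)           ≡⟨ *-assoc p (c′ ∸ 1) (r ^ k) ⟨
      p * (c′ ∸ 1) * r ^ k             ≤⟨ *-monoˡ-≤ (r ^ k) shrunk ⟩
      (c ∸ 1) * r * r ^ k              ≡⟨ *-assoc (c ∸ 1) r (r ^ k) ⟩
      (c ∸ 1) * (r * r ^ k)            ∎))
      where
      open ≤-Reasoning
      c = matchCount A h S
      c′ = matchCount A h (S [ j ]≔ true)
      r = p ∸ q

module _ {m} (A : List (Cube m)) (A-unique : Unique A) (A≢[] : A ≢ []) where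

  open EulerBound using (eNum^kq≤N^p)
  open Fractions using (LeLnTimes-intro; LeLnTimes-zero; frac≤⇒*; ≤-foldr-⊔; 0≤foldr-⊔)
  open SpecifyingSets using (matching-⊥; ≢[]⇒length≢0)
  open Greedy using (greedy)
  open import Data.Nat
  open import Data.Nat.Properties
  import Data.Integer as ℤ
  open import Data.Rational using (ℚ; ↥_; ↧ₙ_)
  open import Data.Fin.Subset using (⊥)
  open import Data.Fin.Subset.Properties using (∣⊥∣≡0)
  open import Data.List.Membership.Propositional using (_∈_)
  open import Data.Product using (_,_)
  open import Data.Sum using (inj₁; inj₂)
  open import Relation.Binary.PropositionalEquality
  open import Relation.Nullary using (contradiction)

  private
    D = DEN A
    N = length A
    p = ℤ.∣ ↥ D ∣
    q = ↧ₙ D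
    instance _ = ≢[]⇒length≢0 A≢[]
    ratio : List (Cube m) → ℚ
    ratio B = frac (length B ∸ 1) (MAMI B)

  density-bound : ∀ {B} → B ∈ sublists A → 1 ≤ MAMI B → (length B ∸ 1) * q ≤ MAMI B * p
  density-bound {B} B∈ 1≤MAMI with MAMI B | ≤-foldr-⊔ ratio B∈
  ... | suc μ | ratio≤D = frac≤⇒* (length B ∸ 1) μ (0≤foldr-⊔ ratio (sublists A)) ratio≤D

  ETDh-bound : ∀ h → LeLnTimes (ETDh A h ∸ 1) N D
  ETDh-bound h with ETDh A h | greedy A A-unique h density-bound (ETDh A h ∸ 1) ⊥
  ... | zero  | _ = LeLnTimes-zero N D
  ... | suc k | inj₁ k<⊥+k = contradiction (subst (λ s → suc k ≤ s + k) (∣⊥∣≡0 m) k<⊥+k) (n≮n k)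
  ... | suc k | inj₂ (p≢0 , bound) =
    LeLnTimes-intro k N D λ n → eNum^kq≤N^p n {N} {p} {q} k {{p≢0}} (≤-trans bound (*-monoˡ-≤ _ c≤N))
    where
    c≤N : matchCount A h ⊥ ∸ 1 ≤ N
    c≤N = ≤-trans (m∸n≤m _ 1) (≤-reflexive (cong length (matching-⊥ A h)))

open SpecifyingSets using (foldr-⊔-attained; ≢[]⇒length≢0)
open Fractions using (LeLnTimes-zero)
open import Data.Product using (_,_)
open import Data.Sum using (inj₁; inj₂)
open import Relation.Binary.PropositionalEquality using (subst; sym)

lemma7 : (m : ℕ) (A : List (Vec Bool m)) → Unique A → A ≢ [] →
    LeLnTimes (ETD A ∸ 1) (length A) (DEN A)
lemma7 m A A-unique A≢[] with foldr-⊔-attained (ETDh A) (allVecs m)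
... | inj₁ ETD≡0          = subst (λ e → LeLnTimes (e ∸ 1) (length A) (DEN A)) (sym ETD≡0)
                              (LeLnTimes-zero (length A) (DEN A) {{≢[]⇒length≢0 A≢[]}})
... | inj₂ (h , ETD≡ETDh) = subst (λ e → LeLnTimes (e ∸ 1) (length A) (DEN A)) (sym ETD≡ETDh)
                              (ETDh-bound A A-unique A≢[] h)
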